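{- Let $V$ be a finite set. Then the assignment $G\mapsto \mathbf{P}_G$ restricts to a bijection from the set $\mathbf{B}(V)$ of connected block graphs with vertex set $V$ onto the set $\mathbf{P}(V)$ of compatible families of $V$-partitions; equivalently, it induces a bijection from the set of block-equivalence classes of connected simple graphs with vertex set $V$ onto $\mathbf{P}(V)$. The inverse map is given by associating to each family $\mathbf{P}=(\mathbf{p}_v)_{v\in V}\in\mathbf{P}(V)$ the graph $B_{\mathbf{P}}:=(V,E_{\mathbf{P}})$ with $$E_{\mathbf{P}}:=\Big\{\{u,v\}\in\tbinom{V}{2}:\ \mathbf{p}_w[u]=\mathbf{p}_w[v]\text{ for all } w\in V-\{u,v\}\Big\}.$$ In particular: (a) for every connected simple graph $G=(V,E)$, the edge set $[E]$ of $[G]$ coincides with the set of all $2$-subsets $\{u,v\}$ of $V$ such that $G^{(w)}[u]=G^{(w)}[v]$ for all $w\in V-\{u,v\}$; and (b) for every $\mathbf{P}=(\mathbf{p}_v)_{v\in V}\in\mathbf{P}(V)$ one has $\pi_0(B_{\mathbf{P}}^{(v)})=\mathbf{p}_v$ for every $v\in V$.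
   Context: All graphs are finite simple graphs with vertex set a fixed finite set $V$ and edge set $E\subseteq\binom{V}{2}$. For a partition $\mathbf{p}$ of a set $Y$ and $y\in Y$, $\mathbf{p}[y]$ denotes the block of $\mathbf{p}$ containing $y$. For a graph $G=(V,E)$: $\pi_0(G)$ is the partition of $V$ into the vertex sets of the connected components of $G$; $G[v]:=\pi_0(G)[v]$; $G^{(v)}$ is the graph $(V,\{e\in E: v\notin e\})$ (all edges at $v$ removed, vertex set still $V$); and $\mathbf{P}_G:=(\pi_0(G^{(v)}))_{v\in V}$, a $V$-indexed family of partitions of $V$. A block graph is a graph in which every block (maximal 2-connected subgraph) is a clique. $[G]$ denotes the graph $(V,[E])$, where $[E]$ is the union of $E$ and all $2$-subsets $\{u,v\}$ of $V$ that are both contained in (the vertex set of) some circuit of $G$; this is the smallest block graph with vertex set $V$ containing $G$. Two graphs $G,G'$ on $V$ are block-equivalent if $[G]=[G']$. $\mathbf{B}(V)$ is the set of connected block graphs with vertex set $V$. A family $\mathbf{P}=(\mathbf{p}_v)_{v\in V}$ of partitions of $V$ is a compatible family of $V$-partitions if $\{v\}\in\mathbf{p}_v$ for all $v\in V$ and $\mathbf{p}_v[u]\cup\mathbf{p}_u[v]=V$ for any two distinct $u,v\in V$; $\mathbf{P}(V)$ denotes the set of all such families. -}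

module Defs where

open import Level using (0ℓ)
open import Data.Nat using (ℕ; _≤_)
open import Data.Fin using (Fin; _≟_)
open import Data.Fin.Properties using (all?)
open import Data.List using (List; []; _∷_; length; _∷ʳ_)
open import Data.List.Relation.Unary.Unique.Propositional using (Unique)
open import Data.List.Relation.Unary.Linked using (Linked)
open import Data.List.Membership.Propositional using (_∈_)
open import Data.Product using (Σ; _×_; _,_; ∃; proj₁; proj₂)
open import Data.Sum using (_⊎_)
import Data.Empty
open import Data.Empty using (⊥)
open import Function.Bundles using (_⇔_)
open import Relation.Nullary using (¬_; Dec; yes; no)
open import Relation.Nullary.Decidable using (_×-dec_; ¬?)
open import Relation.Binary.Core using (Rel)
open import Relation.Binary.Definitions using (Decidable)
open import Relation.Binary.Structures using (IsDecEquivalence; IsEquivalence)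
open import Relation.Binary.PropositionalEquality using (_≡_; _≢_; refl; sym)
open import Relation.Unary using (Pred; _≐_; _∪_; U; ｛_｝)

record Graph (n : ℕ) : Set₁ where
  field
    E      : Rel (Fin n) 0ℓ
    E?     : Decidable E
    E-sym    : ∀ {u v} → E u v → E v u
    E-irrefl : ∀ {u} → ¬ E u u
open Graph public

GraphEq : ∀ {n} → Graph n → Graph n → Set
GraphEq G H = ∀ u v → E G u v ⇔ E H u v

_^_ : ∀ {n} → Graph n → Fin n → Graph n
G ^ v = record
  { E      = λ x y → E G x y × x ≢ v × y ≢ v
  ; E?     = λ x y → E? G x y ×-dec (¬? (x ≟ v) ×-dec ¬? (y ≟ v))
  ; E-sym    = λ { (e , p , q) → Graph.E-sym G e , q , p }
  ; E-irrefl = λ { (e , _) → Graph.E-irrefl G e }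
  }

data Reach {n} (G : Graph n) : Fin n → Fin n → Set where
  here : ∀ {x} → Reach G x x
  step : ∀ {x y z} → E G x y → Reach G y z → Reach G x z

Connected : ∀ {n} → Graph n → Set
Connected G = ∀ u v → Reach G u v

-- Partitions of V are represented by their "same block" relation
-- (an equivalence relation); the block p[y] is the set {x | p y x}.

Block : ∀ {n} → Rel (Fin n) 0ℓ → Fin n → Pred (Fin n) 0ℓ
Block p y = λ x → p y x

π₀ : ∀ {n} → Graph n → Rel (Fin n) 0ℓ
π₀ G = Reach G

Fam : ℕ → Set₁
Fam n = Fin n → Rel (Fin n) 0ℓ

FamEq : ∀ {n} → Fam n → Fam n → Set
FamEq P Q = ∀ v x y → P v x y ⇔ Q v x y

𝐏 : ∀ {n} → Graph n → Fam n
𝐏 G v = π₀ (G ^ v)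

record Compatible {n} (P : Fam n) : Set where
  field
    isPartition : ∀ v → IsDecEquivalence (P v)
    singleton   : ∀ v → Block (P v) v ≐ ｛ v ｝
    cover       : ∀ u v → u ≢ v → (Block (P v) u ∪ Block (P u) v) ≐ U
open Compatible public

E𝐏 : ∀ {n} → Fam n → Rel (Fin n) 0ℓ
E𝐏 P u v = u ≢ v × (∀ w → w ≢ u → w ≢ v → P w u v)

B : ∀ {n} (P : Fam n) → Compatible P → Graph n
B P c = record
  { E      = E𝐏 P
  ; E?     = dec
  ; E-sym    = λ { (ne , f) → (λ eq → ne (sym eq)) ,
                  (λ w p q → IsEquivalence.sym (IsDecEquivalence.isEquivalence (isPartition c w)) (f w q p)) }
  ; E-irrefl = λ { (ne , _) → ne refl }
  }
  where
  dec : Decidable (E𝐏 P)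
  dec u v = ¬? (u ≟ v) ×-dec all? (λ w → all?′ w)
    where
    all?′ : ∀ w → Dec (w ≢ u → w ≢ v → P w u v)
    all?′ w with w ≟ u | w ≟ v | IsDecEquivalence._≟_ (isPartition c w) u v
    ... | yes p | _ | _ = yes (λ a _ → Data.Empty.⊥-elim (a p))
    ... | no _ | yes q | _ = yes (λ _ b → Data.Empty.⊥-elim (b q))
    ... | no _ | no _ | yes r = yes (λ _ _ → r)
    ... | no a | no b | no r = no (λ f → r (f a b))

-- a circuit x ∷ xs : at least 3 distinct vertices, consecutive ones
-- adjacent and the last adjacent to the first
IsCircuit : ∀ {n} → Graph n → List (Fin n) → Set
IsCircuit G []       = ⊥
IsCircuit G (x ∷ xs) = 2 ≤ length xs × Unique (x ∷ xs) × Linked (E G) ((x ∷ xs) ∷ʳ x)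

OnCommonCircuit : ∀ {n} → Graph n → Fin n → Fin n → Set
OnCommonCircuit G u v = Σ (List _) λ cs → IsCircuit G cs × u ∈ cs × v ∈ cs

[E] : ∀ {n} → Graph n → Rel (Fin n) 0ℓ
[E] G u v = E G u v ⊎ (u ≢ v × OnCommonCircuit G u v)

IsBlockGraph : ∀ {n} → Graph n → Set
IsBlockGraph G = ∀ u v → [E] G u v ⇔ E G u v

BlockEquiv : ∀ {n} → Graph n → Graph n → Set
BlockEquiv G H = ∀ u v → [E] G u v ⇔ [E] H u v

{-# OPTIONS --safe #-}
-- Say that w separates u and v when w ∉ {u,v} and u, v lie in different components of G^(w).
-- Adjacent vertices are separated by no w, and neither are two vertices of a common circuit,
-- since deleting w from the circuit leaves a path through the others. Conversely, let no vertex
-- separate u and v in a connected G, and follow a simple path u, a₁, …, aₖ = v. Starting from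
-- the edge a₁u, keep two internally disjoint paths from aᵢ to u: a path from aᵢ₊₁ to u avoiding
-- aᵢ, cut at its first vertex x on them, is spliced onto the path through x, and the edge
-- aᵢ₊₁aᵢ onto the other. At v the two paths close up to a circuit through u and v unless u and
-- v are adjacent. This is (a), and it shows that 𝐏_G only depends on [G].
-- For a compatible family P, a vertex separating x from a separator w of x and y also separates
-- x and y (compatibility at the pair of separators). Hence induction on the number of separators
-- joins any x, y by a path of B_P, avoiding v when x, y ≠ v lie in one block of p_v; this gives
-- (b) and connectedness of B_P, and (b) with the easy half of (a) shows that B_P is a block graph.
module Submission where

open import Defs
open import Level using (0ℓ)
open import Data.Nat using (ℕ; zero; suc; _≤_; _<_; z≤n; s≤s)
open import Data.Nat.Properties using (≤-trans; ≤-reflexive)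
open import Data.Nat.Induction using (<-wellFounded)
open import Induction.WellFounded using (Acc; acc)
open import Data.Fin using (Fin; _≟_)
open import Data.Fin.Properties using (any?)
open import Data.List as List using (List; []; _∷_; _++_; _∷ʳ_; length; filter; allFin)
open import Data.List.Properties using (++-assoc; unfold-reverse; filter-notAll; length-tabulate)
open import Data.List.Membership.Propositional using (_∈_; _∉_)
open import Data.List.Membership.Propositional.Properties using (∈-++⁺ˡ; ∈-++⁺ʳ; ∈-++⁻; ∈-∃++; ∈-allFin; ∈-filter⁺; ∈-length)
open import Data.List.Relation.Binary.Disjoint.Propositional using (Disjoint)
open import Data.List.Relation.Binary.Permutation.Propositional using (↭-sym; ↭⇒↭ₛ)
open import Data.List.Relation.Binary.Permutation.Propositional.Properties using (↭-reverse)
open import Data.List.Relation.Binary.Permutation.Setoid.Properties using (Unique-resp-↭)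
open import Data.List.Relation.Binary.Subset.Propositional using (_⊆_)
open import Data.List.Relation.Unary.Any using (Any; here; there)
import Data.List.Relation.Unary.Any as Any
open import Data.List.Relation.Unary.Any.Properties using (reverse⁻)
open import Data.List.Relation.Unary.All using (All; []; _∷_)
import Data.List.Relation.Unary.All as All
open import Data.List.Relation.Unary.All.Properties using (¬Any⇒All¬; All¬⇒¬Any) renaming (++⁻ˡ to All-++⁻ˡ)
open import Data.List.Relation.Unary.AllPairs using ([]; _∷_)
open import Data.List.Relation.Unary.Unique.Propositional using (Unique)
open import Data.List.Relation.Unary.Unique.Propositional.Properties using (++⁺; Unique[x∷xs]⇒x∉xs)
open import Data.List.Relation.Unary.Linked using (Linked; []; [-]; _∷_)
import Data.List.Relation.Unary.Linked as Linked
open import Data.Product using (Σ-syntax; _×_; _,_; ∃; proj₁; proj₂; map₂)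
open import Data.Sum using (_⊎_; inj₁; inj₂; [_,_]′)
import Data.Sum as Sum
open import Data.Empty using (⊥; ⊥-elim)
open import Data.Unit using (⊤; tt)
open import Function using (_∘_; id)
open import Function.Bundles using (_⇔_; mk⇔; Equivalence)
open import Function.Construct.Composition using (_⇔-∘_)
open import Function.Construct.Symmetry using (⇔-sym)
open import Relation.Nullary using (¬_; Dec; yes; no)
open import Relation.Nullary.Decidable using (_×-dec_; _⊎-dec_; ¬?; map′; decidable-stable)
open import Relation.Binary.Core using (Rel)
open import Relation.Binary.Definitions using (Decidable; DecidableEquality; Reflexive; Transitive)
open import Relation.Binary.Structures using (IsDecEquivalence)
import Relation.Binary.PropositionalEquality as ≡
open import Relation.Binary.PropositionalEquality using (_≡_; _≢_; refl; sym; cong; subst; ≢-sym; module ≡-Reasoning)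

private variable
  A : Set
  R : Rel A 0ℓ
  xs ys : List A

Unique-++⁻ : ∀ xs → Unique (xs ++ ys) → Unique xs × Unique ys × Disjoint xs ys
Unique-++⁻ [] u = [] , u , λ ()
Unique-++⁻ (x ∷ xs) (x∉ ∷ u) with Unique-++⁻ xs u
... | uxs , uys , disjoint =
  All-++⁻ˡ xs x∉ ∷ uxs , uys ,
  λ { (here refl , v∈ys) → All.lookup x∉ (∈-++⁺ʳ xs v∈ys) refl
    ; (there v∈xs , v∈ys) → disjoint (v∈xs , v∈ys) }

Unique-reverse : {xs : List A} → Unique xs → Unique (List.reverse xs)
Unique-reverse {A = A} {xs = xs} = Unique-resp-↭ (≡.setoid A) (↭⇒↭ₛ (↭-sym (↭-reverse xs)))

module _ {A : Set} (_≟_ : DecidableEquality A) where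

  Unique∧⊆⇒length≤ : {xs ys : List A} → Unique xs → xs ⊆ ys → length xs ≤ length ys
  Unique∧⊆⇒length≤ {[]} _ _ = z≤n
  Unique∧⊆⇒length≤ {x ∷ xs} {ys} (x∉xs ∷ u) xxs⊆ys =
    ≤-trans (s≤s (Unique∧⊆⇒length≤ u xs⊆ys′)) (filter-notAll ≢x? ys x∈ys)
    where
    ≢x? = λ z → ¬? (x ≟ z)
    x∈ys : Any (λ z → ¬ ¬ x ≡ z) ys
    x∈ys = Any.map (λ x≡z x≢z → x≢z x≡z) (xxs⊆ys (here refl))
    xs⊆ys′ : xs ⊆ filter ≢x? ys
    xs⊆ys′ z∈xs = ∈-filter⁺ ≢x? (xxs⊆ys (there z∈xs)) (All.lookup x∉xs z∈xs)

linked-++⁻ˡ : ∀ xs → Linked R (xs ++ ys) → Linked R xs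
linked-++⁻ˡ [] _ = []
linked-++⁻ˡ (x ∷ []) _ = [-]
linked-++⁻ˡ (x ∷ y ∷ xs) (r ∷ l) = r ∷ linked-++⁻ˡ (y ∷ xs) l

linked-++⁻ʳ : ∀ xs → Linked R (xs ++ ys) → Linked R ys
linked-++⁻ʳ [] l = l
linked-++⁻ʳ (x ∷ xs) l = linked-++⁻ʳ xs (Linked.tail l)

linked-join : ∀ xs {x : A} → Linked R (xs ∷ʳ x) → Linked R (x ∷ ys) → Linked R (xs ++ x ∷ ys)
linked-join [] _ l = l
linked-join (_ ∷ []) (r ∷ _) l = r ∷ l
linked-join (_ ∷ _ ∷ xs) (r ∷ l₁) l = r ∷ linked-join (_ ∷ xs) l₁ l

module _ {n : ℕ} {G : Graph n} where

  initVertices : ∀ {x y} → Reach G x y → List (Fin n)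
  initVertices here = []
  initVertices (step {x = x} _ w) = x ∷ initVertices w

  -- Defined through initVertices so that vertices (step e w) reduces to x ∷ vertices w.
  vertices : ∀ {x y} → Reach G x y → List (Fin n)
  vertices {y = y} w = initVertices w ∷ʳ y

  Simple : ∀ {x y} → Reach G x y → Set
  Simple w = Unique (vertices w)

  head∈ : ∀ {x y} (w : Reach G x y) → x ∈ vertices w
  head∈ here = here refl
  head∈ (step _ _) = here refl

  last∈ : ∀ {x y} (w : Reach G x y) → y ∈ vertices w
  last∈ w = ∈-++⁺ʳ (initVertices w) (here refl)

  initVertices⊆vertices : ∀ {x y} (w : Reach G x y) → initVertices w ⊆ vertices w
  initVertices⊆vertices w = ∈-++⁺ˡ

  head∈initVertices : ∀ {x y} → x ≢ y → (w : Reach G x y) → x ∈ initVertices w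
  head∈initVertices x≢x here = ⊥-elim (x≢x refl)
  head∈initVertices _ (step _ _) = here refl

  simple⇒Unique-initVertices : ∀ {x y} (w : Reach G x y) → Simple w → Unique (initVertices w)
  simple⇒Unique-initVertices w = proj₁ ∘ Unique-++⁻ (initVertices w)

  simple⇒last∉initVertices : ∀ {x y} (w : Reach G x y) → Simple w → y ∉ initVertices w
  simple⇒last∉initVertices w s y∈ = proj₂ (proj₂ (Unique-++⁻ (initVertices w) s)) (y∈ , here refl)

  linked-vertices : ∀ {x y} (w : Reach G x y) → Linked (E G) (vertices w)
  linked-vertices here = [-]
  linked-vertices (step e here) = e ∷ [-]
  linked-vertices (step e w@(step _ _)) = e ∷ linked-vertices w

  infixr 5 _◅◅_
  _◅◅_ : ∀ {x y z} → Reach G x y → Reach G y z → Reach G x z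
  here ◅◅ w₂ = w₂
  step e w₁ ◅◅ w₂ = step e (w₁ ◅◅ w₂)

  initVertices-◅◅ : ∀ {x y z} (w₁ : Reach G x y) (w₂ : Reach G y z) →
                    initVertices (w₁ ◅◅ w₂) ≡ initVertices w₁ ++ initVertices w₂
  initVertices-◅◅ here w₂ = refl
  initVertices-◅◅ (step _ w₁) w₂ = cong (_ ∷_) (initVertices-◅◅ w₁ w₂)

  vertices-◅◅ : ∀ {x y z} (w₁ : Reach G x y) (w₂ : Reach G y z) →
                vertices (w₁ ◅◅ w₂) ≡ initVertices w₁ ++ vertices w₂
  vertices-◅◅ {z = z} w₁ w₂ = begin
    initVertices (w₁ ◅◅ w₂) ∷ʳ z                    ≡⟨ cong (_∷ʳ z) (initVertices-◅◅ w₁ w₂) ⟩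
    (initVertices w₁ ++ initVertices w₂) ∷ʳ z       ≡⟨ ++-assoc (initVertices w₁) (initVertices w₂) _ ⟩
    initVertices w₁ ++ vertices w₂                  ∎
    where open ≡-Reasoning

  ∈-◅◅⁻ : ∀ {x y z v} (w₁ : Reach G x y) (w₂ : Reach G y z) →
          v ∈ vertices (w₁ ◅◅ w₂) → v ∈ initVertices w₁ ⊎ v ∈ vertices w₂
  ∈-◅◅⁻ w₁ w₂ = ∈-++⁻ (initVertices w₁) ∘ subst (_ ∈_) (vertices-◅◅ w₁ w₂)

  ∈-◅◅⁺ʳ : ∀ {x y z v} (w₁ : Reach G x y) (w₂ : Reach G y z) →
           v ∈ vertices w₂ → v ∈ vertices (w₁ ◅◅ w₂)
  ∈-◅◅⁺ʳ w₁ w₂ = subst (_ ∈_) (sym (vertices-◅◅ w₁ w₂)) ∘ ∈-++⁺ʳ (initVertices w₁)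

  simple-◅◅⁺ : ∀ {x y z} (w₁ : Reach G x y) (w₂ : Reach G y z) → Unique (initVertices w₁) → Simple w₂ →
               Disjoint (initVertices w₁) (vertices w₂) → Simple (w₁ ◅◅ w₂)
  simple-◅◅⁺ w₁ w₂ u₁ s₂ disjoint = subst Unique (sym (vertices-◅◅ w₁ w₂)) (++⁺ u₁ s₂ disjoint)

  simple-◅◅⁻ : ∀ {x y z} (w₁ : Reach G x y) (w₂ : Reach G y z) → Simple (w₁ ◅◅ w₂) →
               Simple w₂ × Disjoint (initVertices w₁) (vertices w₂)
  simple-◅◅⁻ w₁ w₂ s with Unique-++⁻ (initVertices w₁) (subst Unique (vertices-◅◅ w₁ w₂) s)
  ... | _ , s₂ , disjoint = s₂ , disjoint

  reverse : ∀ {x y} → Reach G x y → Reach G y x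
  reverse here = here
  reverse (step e w) = reverse w ◅◅ step (E-sym G e) here

  vertices-reverse : ∀ {x y} (w : Reach G x y) → vertices (reverse w) ≡ List.reverse (vertices w)
  vertices-reverse here = refl
  vertices-reverse {x = x} (step {y = y} e w) = begin
    vertices (reverse w ◅◅ step (E-sym G e) here)   ≡⟨ vertices-◅◅ (reverse w) _ ⟩
    initVertices (reverse w) ++ y ∷ x ∷ []          ≡⟨ ++-assoc (initVertices (reverse w)) _ _ ⟨
    vertices (reverse w) ∷ʳ x                       ≡⟨ cong (_∷ʳ x) (vertices-reverse w) ⟩
    List.reverse (vertices w) ∷ʳ x                  ≡⟨ unfold-reverse x (vertices w) ⟨
    List.reverse (x ∷ vertices w)                   ∎
    where open ≡-Reasoning

  simple-reverse : ∀ {x y} (w : Reach G x y) → Simple w → Simple (reverse w)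
  simple-reverse w = subst Unique (sym (vertices-reverse w)) ∘ Unique-reverse

  ∈-reverse⁻ : ∀ {x y v} (w : Reach G x y) → v ∈ vertices (reverse w) → v ∈ vertices w
  ∈-reverse⁻ w = reverse⁻ ∘ subst (_ ∈_) (vertices-reverse w)

  splitAt : ∀ {x y z} (w : Reach G x y) → z ∈ vertices w →
            Σ[ w₁ ∈ Reach G x z ] Σ[ w₂ ∈ Reach G z y ] w ≡ w₁ ◅◅ w₂
  splitAt here (here refl) = here , here , refl
  splitAt (step e w) (here refl) = here , step e w , refl
  splitAt (step e w) (there z∈w) with splitAt w z∈w
  ... | w₁ , w₂ , refl = step e w₁ , w₂ , refl

  simplify : ∀ {x y} (w : Reach G x y) → Σ[ w′ ∈ Reach G x y ] Simple w′ × vertices w′ ⊆ vertices w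
  simplify here = here , [] ∷ [] , id
  simplify (step {x = x} e w) with simplify w
  ... | w′ , w′-simple , w′⊆w with Any.any? (x ≟_) (vertices w′)
  ...   | no x∉w′ =
    step e w′ , ¬Any⇒All¬ _ x∉w′ ∷ w′-simple , λ { (here refl) → here refl ; (there v∈) → there (w′⊆w v∈) }
  ...   | yes x∈w′ with splitAt w′ x∈w′
  ...     | w₁ , w₂ , refl =
    w₂ , proj₁ (simple-◅◅⁻ w₁ w₂ w′-simple) , there ∘ w′⊆w ∘ ∈-◅◅⁺ʳ w₁ w₂

  firstHit : ∀ (S : Fin n → Set) → (∀ z → Dec (S z)) → ∀ {x y} (p : Reach G x y) → S y →
             Σ[ z ∈ Fin n ] S z × Σ[ w ∈ Reach G x z ]
               vertices w ⊆ vertices p × (∀ {v} → v ∈ vertices w → S v → v ≡ z)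
  firstHit S S? {x} p Sy with S? x
  ... | yes Sx = x , Sx , here , (λ { (here refl) → head∈ p }) , λ { (here refl) _ → refl }
  firstHit S S? here Sy | no ¬Sx = ⊥-elim (¬Sx Sy)
  firstHit S S? (step e p) Sy | no ¬Sx with firstHit S S? p Sy
  ... | z , Sz , w , w⊆p , first =
    z , Sz , step e w , (λ { (here refl) → here refl ; (there v∈) → there (w⊆p v∈) }) ,
    λ { (here refl) Sv → ⊥-elim (¬Sx Sv) ; (there v∈) Sv → first v∈ Sv }

  linked⇒reach : ∀ {xs a b} → Linked (E G) xs → a ∈ xs → b ∈ xs → Reach G a b
  linked⇒reach {_ ∷ _} l a∈ b∈ = reverse (from-head l a∈) ◅◅ from-head l b∈
    where
    from-head : ∀ {h t c} → Linked (E G) (h ∷ t) → c ∈ h ∷ t → Reach G h c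
    from-head _ (here refl) = here
    from-head (e ∷ l) (there c∈) = step e (from-head l c∈)

module _ {n : ℕ} (G : Graph n) where

  -- k bounds the number of vertices of the walk, not its steps, so ReachIn 0 is empty.
  ReachIn : ℕ → Rel (Fin n) 0ℓ
  ReachIn zero x y = ⊥
  ReachIn (suc k) x y = x ≡ y ⊎ ∃ λ z → E G x z × ReachIn k z y

  reachIn? : ∀ k → Decidable (ReachIn k)
  reachIn? zero x y = no λ ()
  reachIn? (suc k) x y = (x ≟ y) ⊎-dec any? (λ z → E? G x z ×-dec reachIn? k z y)

  reachIn⇒reach : ∀ k {x y} → ReachIn k x y → Reach G x y
  reachIn⇒reach (suc k) (inj₁ refl) = here
  reachIn⇒reach (suc k) (inj₂ (z , e , r)) = step e (reachIn⇒reach k r)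

  reach⇒reachIn : ∀ k {x y} (w : Reach G x y) → length (vertices w) ≤ k → ReachIn k x y
  reach⇒reachIn (suc k) here _ = inj₁ refl
  reach⇒reachIn (suc k) (step e w) (s≤s len) = inj₂ (_ , e , reach⇒reachIn k w len)

  reach? : Decidable (Reach G)
  reach? x y = map′ (reachIn⇒reach n) reach⇒reachIn-n (reachIn? n x y)
    where
    reach⇒reachIn-n : Reach G x y → ReachIn n x y
    reach⇒reachIn-n w with simplify w
    ... | w′ , w′-simple , _ = reach⇒reachIn n w′ (≤-trans
            (Unique∧⊆⇒length≤ _≟_ w′-simple (λ {z} _ → ∈-allFin z)) (≤-reflexive (length-tabulate id)))

  Reach-isDecEquivalence : IsDecEquivalence (Reach G)
  Reach-isDecEquivalence = record
    { isEquivalence = record { refl = here ; sym = reverse ; trans = _◅◅_ }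
    ; _≟_ = reach?
    }

module _ {n : ℕ} {G : Graph n} where

  isolated : ∀ {v x} → Reach (G ^ v) v x → v ≡ x
  isolated here = refl
  isolated (step (_ , v≢v , _) _) = ⊥-elim (v≢v refl)

  lower : ∀ {a x y} → x ≢ a → Reach (G ^ a) x y → Σ[ w ∈ Reach G x y ] a ∉ vertices w
  lower x≢a here = here , λ { (here a≡x) → x≢a (sym a≡x) }
  lower x≢a (step (e , _ , y≢a) p) with lower y≢a p
  ... | w , a∉w = step e w , λ { (here a≡x) → x≢a (sym a≡x) ; (there a∈w) → a∉w a∈w }

  lift : ∀ {a x y} (w : Reach G x y) → a ∉ vertices w → Reach (G ^ a) x y
  lift here _ = here
  lift (step e w) a∉ =
    step (e , (λ { refl → a∉ (here refl) }) , (λ { refl → a∉ (there (head∈ w)) })) (lift w (a∉ ∘ there))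

  linked-avoid : ∀ {a xs} → Linked (E G) xs → a ∉ xs → Linked (E (G ^ a)) xs
  linked-avoid [] _ = []
  linked-avoid [-] _ = [-]
  linked-avoid (e ∷ l) a∉ =
    (e , (λ { refl → a∉ (here refl) }) , (λ { refl → a∉ (there (here refl)) })) ∷ linked-avoid l (a∉ ∘ there)

  circuit-minus : ∀ {cs} → IsCircuit G cs → ∀ w →
                  ∃ λ xs → Linked (E G) xs × w ∉ xs × (∀ {z} → z ∈ cs → z ≢ w → z ∈ xs)
  circuit-minus {x ∷ xs} (_ , unique , linked) w with Any.any? (w ≟_) (x ∷ xs)
  ... | no w∉ = x ∷ xs , linked-++⁻ˡ (x ∷ xs) linked , w∉ , λ z∈ _ → z∈
  ... | yes w∈ with ∈-∃++ w∈
  ...   | [] , Bs , refl =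
    Bs , linked-++⁻ˡ Bs (Linked.tail linked) , Unique[x∷xs]⇒x∉xs unique ,
    λ { (here refl) w≢w → ⊥-elim (w≢w refl) ; (there z∈) _ → z∈ }
  ...   | y ∷ As , Bs , refl with Unique-++⁻ (y ∷ As) unique
  ...     | _ , wBs-unique , disjoint =
    Bs ++ y ∷ As ,
    linked-join Bs (Linked.tail (linked-++⁻ʳ (y ∷ As) linked′)) (linked-++⁻ˡ (y ∷ As) linked′) ,
    [ Unique[x∷xs]⇒x∉xs wBs-unique , (λ w∈yAs → disjoint (w∈yAs , here refl)) ]′ ∘ ∈-++⁻ Bs ,
    λ z∈ z≢w → [ ∈-++⁺ʳ Bs , (λ { (here refl) → ⊥-elim (z≢w refl) ; (there z∈Bs) → ∈-++⁺ˡ z∈Bs }) ]′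
                 (∈-++⁻ (y ∷ As) z∈)
    where
    linked′ : Linked (E G) (y ∷ As ++ w ∷ Bs ∷ʳ y)
    linked′ = subst (λ l → Linked (E G) (y ∷ l)) (++-assoc As (w ∷ Bs) _) linked

  circuit⇒reach : ∀ {cs a b w} → IsCircuit G cs → a ∈ cs → b ∈ cs → w ≢ a → w ≢ b → Reach (G ^ w) a b
  circuit⇒reach {w = w} circuit a∈ b∈ w≢a w≢b with circuit-minus circuit w
  ... | xs , linked , w∉ , ∈xs =
    linked⇒reach (linked-avoid linked w∉) (∈xs a∈ (≢-sym w≢a)) (∈xs b∈ (≢-sym w≢b))

  [E]⇒E𝐏 : ∀ {u v} → [E] G u v → E𝐏 (𝐏 G) u v
  [E]⇒E𝐏 (inj₁ e) = (λ { refl → E-irrefl G e }) , λ _ w≢u w≢v → step (e , ≢-sym w≢u , ≢-sym w≢v) here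
  [E]⇒E𝐏 (inj₂ (u≢v , _ , circuit , u∈ , v∈)) = u≢v , λ _ → circuit⇒reach circuit u∈ v∈

  reach-avoiding-either : ∀ {u v x} → u ≢ v → Reach G x u → Reach (G ^ v) x u ⊎ Reach (G ^ u) x v
  reach-avoiding-either _ here = inj₁ here
  reach-avoiding-either {u} {v} {x} u≢v (step e p) with x ≟ v | x ≟ u | reach-avoiding-either u≢v p
  ... | yes refl | _ | _ = inj₂ here
  ... | no _ | yes refl | _ = inj₁ here
  ... | no x≢v | no _ | inj₁ r = inj₁ (step (e , x≢v , λ { refl → u≢v (sym (isolated r)) }) r)
  ... | no _ | no x≢u | inj₂ r = inj₂ (step (e , x≢u , λ { refl → u≢v (isolated r) }) r)

  𝐏-compatible : Connected G → Compatible (𝐏 G)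
  𝐏-compatible connected = record
    { isPartition = λ v → Reach-isDecEquivalence (G ^ v)
    ; singleton = λ v → isolated , λ { refl → here }
    ; cover = λ u v u≢v → (λ _ → tt) ,
                λ {x} _ → Sum.map reverse reverse (reach-avoiding-either u≢v (connected x u))
    }

reach-transfer : ∀ {n} {G H : Graph n} {w x y} → (∀ {a b} → E G a b → E𝐏 (𝐏 H) a b) →
                 Reach (G ^ w) x y → Reach (H ^ w) x y
reach-transfer _ here = here
reach-transfer {G = G} {H} {w} unseparated (step (e , a≢w , b≢w) p) =
  proj₂ (unseparated e) w (≢-sym a≢w) (≢-sym b≢w) ◅◅ reach-transfer {G = G} {H} unseparated p

module _ {n : ℕ} {P : Fam n} (c : Compatible P) where

  private
    module Part (w : Fin n) = IsDecEquivalence (isPartition c w)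

    p-refl : ∀ {w x} → P w x x
    p-refl {w} = Part.refl w

    p-sym : ∀ {w x y} → P w x y → P w y x
    p-sym {w} = Part.sym w

    p-trans : ∀ {w x y z} → P w x y → P w y z → P w x z
    p-trans {w} = Part.trans w

    p-cover : ∀ {u v} → u ≢ v → ∀ t → P v u t ⊎ P u v t
    p-cover {u} {v} u≢v t = proj₂ (cover c u v u≢v) {t} tt

  Separates : Fin n → Fin n → Fin n → Set
  Separates x y w = w ≢ x × w ≢ y × ¬ P w x y

  separates-sym : ∀ {x y w} → Separates x y w → Separates y x w
  separates-sym (w≢x , w≢y , ¬p) = w≢y , w≢x , ¬p ∘ p-sym

  separates-trans : ∀ {x y w z} → Separates x y w → Separates x w z → Separates x y z
  separates-trans {x} {y} {w} {z} (w≢x , w≢y , ¬pʷxy) (z≢x , z≢w , ¬pᶻxw) = z≢x , z≢y , ¬pᶻxy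
    where
    z≢y : z ≢ y
    z≢y refl = [ ¬pʷxy ∘ p-sym , ¬pᶻxw ∘ p-sym ]′ (p-cover z≢w x)
    ¬pᶻxy : ¬ P z x y
    ¬pᶻxy pᶻxy with p-cover z≢w x | p-cover z≢w y
    ... | inj₂ pᶻwx | _ = ¬pᶻxw (p-sym pᶻwx)
    ... | inj₁ _ | inj₂ pᶻwy = ¬pᶻxw (p-trans pᶻxy (p-sym pᶻwy))
    ... | inj₁ pʷzx | inj₁ pʷzy = ¬pʷxy (p-trans (p-sym pʷzx) pʷzy)

  separates? : ∀ x y w → Dec (Separates x y w)
  separates? x y w = ¬? (w ≟ x) ×-dec ¬? (w ≟ y) ×-dec ¬? (Part._≟_ w x y)

  edge-or-separator : ∀ {x y} → x ≢ y → E𝐏 P x y ⊎ ∃ (Separates x y)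
  edge-or-separator {x} {y} x≢y with any? (separates? x y)
  ... | yes separator = inj₂ separator
  ... | no ¬separator =
    inj₁ (x≢y , λ w w≢x w≢y → decidable-stable (Part._≟_ w x y) λ ¬p → ¬separator (w , w≢x , w≢y , ¬p))

  -- The separators of x and w, and of w and y, are separators of x and y other than w,
  -- so the induction runs on a shrinking list of candidate separators.
  separator-induction : (Inv Goal : Rel (Fin n) 0ℓ) → Reflexive Goal → Transitive Goal →
                        (∀ {x y} → Inv x y → E𝐏 P x y → Goal x y) →
                        (∀ {x y w} → Inv x y → Separates x y w → Inv x w × Inv w y) →
                        ∀ {x y} → Inv x y → Goal x y
  separator-induction Inv Goal goal-refl goal-trans goal-edge inv-split =
    go (allFin n) (<-wellFounded _) (λ {z} _ → ∈-allFin z)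
    where
    go : ∀ {x y} (L : List (Fin n)) → Acc _<_ (length L) → (∀ {z} → Separates x y z → z ∈ L) →
         Inv x y → Goal x y
    go {x} {y} L (acc rec) separators∈L inv with x ≟ y
    ... | yes refl = goal-refl
    ... | no x≢y with edge-or-separator x≢y
    ...   | inj₁ e = goal-edge inv e
    ...   | inj₂ (w , s) = goal-trans (go L′ (rec shorter) separatorsˣʷ∈L′ (proj₁ (inv-split inv s)))
                                      (go L′ (rec shorter) separatorsʷʸ∈L′ (proj₂ (inv-split inv s)))
      where
      ≢w? = λ z → ¬? (z ≟ w)
      L′ = filter ≢w? L
      shorter : length L′ < length L
      shorter = filter-notAll ≢w? L (Any.map (λ { refl w≢w → w≢w refl }) (separators∈L s))
      separatorsˣʷ∈L′ : ∀ {z} → Separates x w z → z ∈ L′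
      separatorsˣʷ∈L′ t@(_ , z≢w , _) = ∈-filter⁺ ≢w? (separators∈L (separates-trans s t)) z≢w
      separatorsʷʸ∈L′ : ∀ {z} → Separates w y z → z ∈ L′
      separatorsʷʸ∈L′ t@(z≢w , _ , _) = ∈-filter⁺ ≢w? (separators∈L yx-separator) z≢w
        where yx-separator = separates-sym (separates-trans (separates-sym s) (separates-sym t))

  reach⇒P : ∀ {w x y} → Reach (B P c ^ w) x y → P w x y
  reach⇒P here = p-refl
  reach⇒P (step ((_ , p) , x≢w , y≢w) r) = p-trans (p _ (≢-sym x≢w) (≢-sym y≢w)) (reach⇒P r)

  B-connected : Connected (B P c)
  B-connected x y =
    separator-induction (λ _ _ → ⊤) (Reach (B P c)) here _◅◅_ (λ _ e → step e here) (λ _ _ → tt , tt) tt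

  P⇒reach : ∀ {v x y} → P v x y → Reach (B P c ^ v) x y
  P⇒reach {v} {x} {y} pᵛxy with x ≟ v
  ... | yes refl = subst (Reach (B P c ^ v) v) (proj₁ (singleton c v) pᵛxy) here
  ... | no x≢v = separator-induction Inv (Reach (B P c ^ v)) here _◅◅_
                   (λ (a≢v , b≢v , _) e → step (e , a≢v , b≢v) here) inv-split (x≢v , y≢v , pᵛxy)
    where
    Inv : Rel (Fin n) 0ℓ
    Inv a b = a ≢ v × b ≢ v × P v a b
    y≢v : y ≢ v
    y≢v refl = x≢v (sym (proj₁ (singleton c v) (p-sym pᵛxy)))
    inv-split : ∀ {a b w} → Inv a b → Separates a b w → Inv a w × Inv w b
    inv-split {a} {b} {w} (a≢v , b≢v , pᵛab) (_ , _ , ¬pʷab) = (a≢v , w≢v , p-sym pᵛwa) , (w≢v , b≢v , pᵛwb)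
      where
      w≢v : w ≢ v
      w≢v refl = ¬pʷab pᵛab
      pᵛwa×pᵛwb : P v w a × P v w b
      pᵛwa×pᵛwb with p-cover (≢-sym w≢v) a | p-cover (≢-sym w≢v) b
      ... | inj₂ pᵛwa | _ = pᵛwa , p-trans pᵛwa pᵛab
      ... | inj₁ _ | inj₂ pᵛwb = p-trans pᵛwb (p-sym pᵛab) , pᵛwb
      ... | inj₁ pʷva | inj₁ pʷvb = ⊥-elim (¬pʷab (p-trans (p-sym pʷva) pʷvb))
      pᵛwa = proj₁ pᵛwa×pᵛwb
      pᵛwb = proj₂ pᵛwa×pᵛwb

  𝐏∘B : FamEq (𝐏 (B P c)) P
  𝐏∘B v x y = mk⇔ reach⇒P P⇒reach

  B-isBlockGraph : IsBlockGraph (B P c)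
  B-isBlockGraph u v = mk⇔ (map₂ (λ connected w w≢u w≢v → reach⇒P (connected w w≢u w≢v)) ∘ [E]⇒E𝐏) inj₁

record DisjointPaths {n} (G : Graph n) (a u : Fin n) : Set where
  constructor disjointPaths
  field
    α β : Reach G a u
    α-simple : Simple α
    β-simple : Simple β
    disjoint : ∀ {z} → z ∈ vertices α → z ∈ vertices β → z ≡ a ⊎ z ≡ u

module _ {n : ℕ} {G : Graph n} where

  swap : ∀ {a u} → DisjointPaths G a u → DisjointPaths G a u
  swap (disjointPaths α β α-simple β-simple disjoint) =
    disjointPaths β α β-simple α-simple (λ z∈β z∈α → disjoint z∈α z∈β)

  edge⇒disjointPaths : ∀ {a u} → E G a u → DisjointPaths G a u
  edge⇒disjointPaths e = disjointPaths (step e here) (step e here) simple simple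
    λ { (here z≡a) _ → inj₁ z≡a ; (there (here z≡u)) _ → inj₂ z≡u }
    where
    simple : Simple {G = G} (step e here)
    simple = ((λ { refl → E-irrefl G e }) ∷ []) ∷ [] ∷ []

  extendThrough : ∀ {a u x y} (t : DisjointPaths G a u) → let open DisjointPaths t in
                  E G a y → y ≢ u → (q : Reach G y x) → Simple q → a ∉ vertices q → x ∈ vertices α →
                  (∀ {z} → z ∈ vertices q → z ∈ vertices α → z ≡ x) →
                  (∀ {z} → z ∈ vertices q → z ∈ vertices β → z ≡ x) →
                  DisjointPaths G y u
  extendThrough {a} {u} {x} {y} (disjointPaths α β α-simple β-simple disjoint) e y≢u q q-simple a∉q x∈α q∩α q∩β
    with splitAt α x∈α
  ... | α₁ , α₂ , refl =
    disjointPaths (q ◅◅ α₂) (step (E-sym G e) β) α′-simple (¬Any⇒All¬ _ y∉β ∷ β-simple) disjoint′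
    where
    x≢a : x ≢ a
    x≢a refl = a∉q (last∈ q)
    α₂-simple = proj₁ (simple-◅◅⁻ α₁ α₂ α-simple)
    a∉α₂ : a ∉ vertices α₂
    a∉α₂ a∈α₂ = proj₂ (simple-◅◅⁻ α₁ α₂ α-simple) (head∈initVertices (≢-sym x≢a) α₁ , a∈α₂)
    x∉q⁻ : x ∉ initVertices q
    x∉q⁻ = simple⇒last∉initVertices q q-simple
    q⁻∩β : Disjoint (initVertices q) (vertices β)
    q⁻∩β (z∈q⁻ , z∈β) with q∩β (initVertices⊆vertices q z∈q⁻) z∈β
    ... | refl = x∉q⁻ z∈q⁻
    q⁻∩α₂ : Disjoint (initVertices q) (vertices α₂)
    q⁻∩α₂ (z∈q⁻ , z∈α₂) with q∩α (initVertices⊆vertices q z∈q⁻) (∈-◅◅⁺ʳ α₁ α₂ z∈α₂)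
    ... | refl = x∉q⁻ z∈q⁻
    α′-simple : Simple (q ◅◅ α₂)
    α′-simple = simple-◅◅⁺ q α₂ (simple⇒Unique-initVertices q q-simple) α₂-simple q⁻∩α₂
    y∉β : y ∉ vertices β
    y∉β y∈β with q∩β (head∈ q) y∈β
    ... | refl = [ x≢a , y≢u ]′ (disjoint x∈α y∈β)
    disjoint′ : ∀ {z} → z ∈ vertices (q ◅◅ α₂) → z ∈ y ∷ vertices β → z ≡ y ⊎ z ≡ u
    disjoint′ _ (here z≡y) = inj₁ z≡y
    disjoint′ z∈α′ (there z∈β) with ∈-◅◅⁻ q α₂ z∈α′
    ... | inj₁ z∈q⁻ = ⊥-elim (q⁻∩β (z∈q⁻ , z∈β))
    ... | inj₂ z∈α₂ with disjoint (∈-◅◅⁺ʳ α₁ α₂ z∈α₂) z∈β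
    ...   | inj₁ refl = ⊥-elim (a∉α₂ z∈α₂)
    ...   | inj₂ z≡u = inj₂ z≡u

  OnPaths : ∀ {a u} → DisjointPaths G a u → Fin n → Set
  OnPaths t z = z ∈ vertices α ⊎ z ∈ vertices β
    where open DisjointPaths t

  onPaths? : ∀ {a u} (t : DisjointPaths G a u) → ∀ z → Dec (OnPaths t z)
  onPaths? t z = Any.any? (z ≟_) (vertices α) ⊎-dec Any.any? (z ≟_) (vertices β)
    where open DisjointPaths t

  pathToPaths : ∀ {a u y} (t : DisjointPaths G a u) → y ≢ a → Reach (G ^ a) y u →
                Σ[ x ∈ Fin n ] OnPaths t x × Σ[ q ∈ Reach G y x ] Simple q × a ∉ vertices q ×
                  (∀ {z} → z ∈ vertices q → OnPaths t z → z ≡ x)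
  pathToPaths t y≢a p with lower y≢a p
  ... | p′ , a∉p′ with firstHit (OnPaths t) (onPaths? t) p′ (inj₁ (last∈ (DisjointPaths.α t)))
  ... | x , x∈ , p₁ , p₁⊆p′ , first with simplify p₁
  ... | q , q-simple , q⊆p₁ = x , x∈ , q , q-simple , a∉p′ ∘ p₁⊆p′ ∘ q⊆p₁ , first ∘ q⊆p₁

  extend : ∀ {a u y} → DisjointPaths G a u → E G a y → y ≢ u → Reach (G ^ a) y u → DisjointPaths G y u
  extend t e y≢u p with pathToPaths t (λ { refl → E-irrefl G e }) p
  ... | _ , inj₁ x∈α , q , q-simple , a∉q , first =
    extendThrough t e y≢u q q-simple a∉q x∈α (λ z∈q → first z∈q ∘ inj₁) (λ z∈q → first z∈q ∘ inj₂)
  ... | _ , inj₂ x∈β , q , q-simple , a∉q , first =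
    extendThrough (swap t) e y≢u q q-simple a∉q x∈β (λ z∈q → first z∈q ∘ inj₂) (λ z∈q → first z∈q ∘ inj₁)

  extendAlong : ∀ {a u v} → (∀ w → w ≢ u → w ≢ v → Reach (G ^ w) u v) →
                (R : Reach G a v) → Simple R → u ∉ vertices R → DisjointPaths G a u → DisjointPaths G v u
  extendAlong _ here _ _ t = t
  extendAlong {a} {u} {v} unseparated (step {y = y} e R) (a∉R ∷ R-simple) u∉aR t =
    extendAlong unseparated R R-simple (u∉aR ∘ there) (extend t e y≢u y⇝u)
    where
    y≢u : y ≢ u
    y≢u refl = u∉aR (there (head∈ R))
    a≢u : a ≢ u
    a≢u refl = u∉aR (here refl)
    a≢v : a ≢ v
    a≢v = All.lookup a∉R (last∈ R)
    y⇝u : Reach (G ^ a) y u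
    y⇝u = lift R (All¬⇒¬Any a∉R) ◅◅ reverse (unseparated a a≢u a≢v)

  cycle⇒circuit : ∀ {v} (c : Reach G v v) → Unique (initVertices c) → 3 ≤ length (initVertices c) →
                  IsCircuit G (initVertices c)
  cycle⇒circuit (step e c) unique (s≤s long) = long , unique , linked-vertices (step e c)

  disjointPaths⇒circuit : ∀ {u v} → ¬ E G v u → u ≢ v → DisjointPaths G v u → OnCommonCircuit G u v
  disjointPaths⇒circuit _ u≢v (disjointPaths here _ _ _ _) = ⊥-elim (u≢v refl)
  disjointPaths⇒circuit ¬e _ (disjointPaths (step e here) _ _ _ _) = ⊥-elim (¬e e)
  disjointPaths⇒circuit {u} {v} _ u≢v (disjointPaths α@(step _ (step _ α₂)) β α-simple@(v∉α ∷ _) β-simple disjoint) =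
    initVertices cycle , cycle⇒circuit cycle unique long , u∈ , here refl
    where
    β⁻¹ = reverse β
    cycle = α ◅◅ β⁻¹
    β⁻¹-simple = simple-reverse β β-simple
    initVertices-cycle : initVertices cycle ≡ initVertices α ++ initVertices β⁻¹
    initVertices-cycle = initVertices-◅◅ α β⁻¹
    disjoint⁻ : Disjoint (initVertices α) (initVertices β⁻¹)
    disjoint⁻ (z∈α , z∈β⁻¹)
      with disjoint (initVertices⊆vertices α z∈α) (∈-reverse⁻ β (initVertices⊆vertices β⁻¹ z∈β⁻¹))
    ... | inj₁ refl = simple⇒last∉initVertices β⁻¹ β⁻¹-simple z∈β⁻¹
    ... | inj₂ refl = simple⇒last∉initVertices α α-simple z∈α
    unique : Unique (initVertices cycle)
    unique = subst Unique (sym initVertices-cycle)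
      (++⁺ (simple⇒Unique-initVertices α α-simple) (simple⇒Unique-initVertices β⁻¹ β⁻¹-simple) disjoint⁻)
    long : 3 ≤ length (initVertices cycle)
    long = s≤s (s≤s (∈-length (head∈initVertices y₂≢v (α₂ ◅◅ β⁻¹))))
      where y₂≢v = ≢-sym (All.lookup v∉α (there (head∈ α₂)))
    u∈ : u ∈ initVertices cycle
    u∈ = subst (u ∈_) (sym initVertices-cycle) (∈-++⁺ʳ (initVertices α) (head∈initVertices u≢v β⁻¹))

  unseparated⇒[E] : Connected G → ∀ {u v} → E𝐏 (𝐏 G) u v → [E] G u v
  unseparated⇒[E] connected {u} {v} (u≢v , unseparated) with E? G u v | simplify (connected u v)
  ... | yes e | _ = inj₁ e
  ... | no _ | here , _ = ⊥-elim (u≢v refl)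
  ... | no ¬e | step e R , u∉R ∷ R-simple , _ =
    inj₂ (u≢v , disjointPaths⇒circuit (¬e ∘ E-sym G) u≢v
                  (extendAlong unseparated R R-simple (All¬⇒¬Any u∉R) (edge⇒disjointPaths (E-sym G e))))

[E]⇔E𝐏∘𝐏 : ∀ {n} {G : Graph n} → Connected G → ∀ u v → [E] G u v ⇔ E𝐏 (𝐏 G) u v
[E]⇔E𝐏∘𝐏 connected u v = mk⇔ [E]⇒E𝐏 (unseparated⇒[E] connected)

E𝐏-cong : ∀ {n} {P Q : Fam n} → FamEq P Q → ∀ {u v} → E𝐏 P u v ⇔ E𝐏 Q u v
E𝐏-cong P≡Q = mk⇔ (map₂ λ sep w w≢u w≢v → Equivalence.to (P≡Q w _ _) (sep w w≢u w≢v))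
                  (map₂ λ sep w w≢u w≢v → Equivalence.from (P≡Q w _ _) (sep w w≢u w≢v))

blockEquiv⇔𝐏-equal : ∀ {n} {G H : Graph n} → Connected G → Connected H →
                     BlockEquiv G H ⇔ FamEq (𝐏 G) (𝐏 H)
blockEquiv⇔𝐏-equal {G = G} {H} cG cH = mk⇔
  (λ G≈H w x y → mk⇔ (reach-transfer {G = G} {H} ([E]⇒E𝐏 ∘ Equivalence.to (G≈H _ _) ∘ inj₁))
                     (reach-transfer {G = H} {G} ([E]⇒E𝐏 ∘ Equivalence.from (G≈H _ _) ∘ inj₁)))
  (λ 𝐏G≡𝐏H u v → ⇔-sym ([E]⇔E𝐏∘𝐏 cH u v) ⇔-∘ (E𝐏-cong 𝐏G≡𝐏H ⇔-∘ [E]⇔E𝐏∘𝐏 cG u v))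

B∘𝐏-blockGraph : ∀ {n} {G : Graph n} → Connected G → IsBlockGraph G → (c : Compatible (𝐏 G)) →
                 GraphEq (B (𝐏 G) c) G
B∘𝐏-blockGraph connected block c u v = block u v ⇔-∘ ⇔-sym ([E]⇔E𝐏∘𝐏 connected u v)

mainTheorem1 : (n : ℕ) →
    -- G ↦ 𝐏_G sends connected graphs (in particular B(V)) into P(V)
    (∀ (G : Graph n) → Connected G → Compatible (𝐏 G))
    -- it is constant exactly on block-equivalence classes of connected graphs
    × (∀ (G H : Graph n) → Connected G → Connected H → (BlockEquiv G H ⇔ FamEq (𝐏 G) (𝐏 H)))
    -- P ↦ B_P lands in B(V)
    × (∀ (P : Fam n) (c : Compatible P) → Connected (B P c) × IsBlockGraph (B P c))
    -- B_{𝐏_G} = G for G ∈ B(V)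
    × (∀ (G : Graph n) → Connected G → IsBlockGraph G → (c : Compatible (𝐏 G)) → GraphEq (B (𝐏 G) c) G)
    -- (b): 𝐏_{B_P} = P, i.e. π0(B_P^(v)) = p_v for all v
    × (∀ (P : Fam n) (c : Compatible P) → FamEq (𝐏 (B P c)) P)
    -- (a): [E] = {{u,v} : G^(w)[u] = G^(w)[v] for all w ∉ {u,v}}
    × (∀ (G : Graph n) → Connected G → ∀ (u v : Fin n) → [E] G u v ⇔ E𝐏 (𝐏 G) u v)
mainTheorem1 n =
    (λ G → 𝐏-compatible)
  , (λ G H → blockEquiv⇔𝐏-equal)
  , (λ P c → B-connected c , B-isBlockGraph c)
  , (λ G → B∘𝐏-blockGraph)
  , (λ P → 𝐏∘B)
  , (λ G → [E]⇔E𝐏∘𝐏)
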